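{- Let $A\subseteq[1..m^2]$ be a nonempty set of size $|A|=m$, written $A=\{a_1<a_2<\dots<a_m\}$, and let $a_0=0$, $a_{m+1}=m^2$. Let $b_i=i\bmod 2$ for $i\in[0..m]$, $k=1+\lfloor\log_2 m\rfloor$, and $T=\bigodot_{i=0}^{m}\big(b_i\cdot \mathrm{ebin}_k(i)\big)^{a_{i+1}-a_i}\in\{0,1\}^*$. Then for every $x\in[1..m^2]$, $\mathrm{PredColor}(A,x)=\mathrm{BWT}_T[b+x]$, where $b=|\{j\in[1..|T|]: T[j..|T|]\prec 1^{k+1}0\}|$.
   Context: $\mathrm{bin}_k(x)\in\{0,1\}^k$ is the binary representation of $x\in[0..2^k)$ with leading zeros, and $\mathrm{ebin}_k(x)=1^{k+1}\cdot 0\cdot \mathrm{bin}_k(x)\cdot 0$. $\bigodot$ is concatenation, $S^t$ is $t$ copies of $S$, and $0\prec1$. Lexicographic order: a proper prefix is smaller, otherwise compare at first difference. $\mathrm{PredColor}(A,x)=|\{y\in A: y<x\}|\bmod 2$. For a string $S$ of length $N$, $\mathrm{SA}_S$ lists its suffix starting positions in increasing lexicographic order and $\mathrm{BWT}_S[i]=S[\mathrm{SA}_S[i]-1]$ if $\mathrm{SA}_S[i]>1$ and $S[N]$ otherwise. -}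

module Defs where

open import Data.Nat using (ℕ; zero; suc; _+_; _*_; _∸_; _<_; _<ᵇ_; _≡ᵇ_)
open import Data.Nat.DivMod using (_/_; _%_)
open import Data.Nat.Logarithm using (⌊log₂_⌋)
open import Data.Nat.Properties using (_<?_)
open import Data.Bool using (Bool; true; false; if_then_else_; _∧_; _∨_)
open import Data.List using (List; []; _∷_; _++_; [_]; replicate; concat; zipWith; length; filter; drop; upTo; map)
open import Data.Maybe using (Maybe; just; nothing)

-- Strings over the alphabet {0,1} are lists of naturals with entries 0 or 1 (0 ≺ 1).

bin : ℕ → ℕ → List ℕ
bin zero    x = []
bin (suc k) x = bin k (x / 2) ++ [ x % 2 ]

ebin : ℕ → ℕ → List ℕ
ebin k x = replicate (suc k) 1 ++ (0 ∷ bin k x ++ [ 0 ])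

lexLt : List ℕ → List ℕ → Bool
lexLt []       []       = false
lexLt []       (_ ∷ _)  = true
lexLt (_ ∷ _)  []       = false
lexLt (x ∷ xs) (y ∷ ys) = (x <ᵇ y) ∨ ((x ≡ᵇ y) ∧ lexLt xs ys)

-- 1-based indexing S[j]
at : List ℕ → ℕ → Maybe ℕ
at []       _             = nothing
at (_ ∷ _)  zero          = nothing
at (c ∷ _)  (suc zero)    = just c
at (_ ∷ cs) (suc (suc j)) = at cs (suc j)

suffix : List ℕ → ℕ → List ℕ
suffix S j = drop (j ∸ 1) S

positions : ℕ → List ℕ
positions n = map suc (upTo n)

count : (ℕ → Bool) → List ℕ → ℕ
count p []       = 0
count p (x ∷ xs) = if p x then suc (count p xs) else count p xs

rank : List ℕ → ℕ → ℕ
rank S p = count (λ q → lexLt (suffix S q) (suffix S p)) (positions (length S))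

-- SA_S[i] (1-based): the position whose suffix is the i-th smallest,
-- i.e. exactly i-1 suffixes are smaller (suffixes are pairwise distinct).
findFirst : (ℕ → Bool) → List ℕ → Maybe ℕ
findFirst p []       = nothing
findFirst p (x ∷ xs) = if p x then just x else findFirst p xs

SA : List ℕ → ℕ → Maybe ℕ
SA S i = findFirst (λ p → rank S p ≡ᵇ (i ∸ 1)) (positions (length S))

-- BWT_S[i] = S[SA_S[i]-1] if SA_S[i] > 1, else S[|S|]
bwtChar : List ℕ → ℕ → Maybe ℕ
bwtChar S (suc (suc p)) = at S (suc p)
bwtChar S _             = at S (length S)

bindM : Maybe ℕ → (ℕ → Maybe ℕ) → Maybe ℕ
bindM nothing  f = nothing
bindM (just x) f = f x

BWT : List ℕ → ℕ → Maybe ℕ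
BWT S i = bindM (SA S i) (bwtChar S)

PredColor : List ℕ → ℕ → ℕ
PredColor A x = length (filter (_<? x) A) % 2

kOf : ℕ → ℕ
kOf m = suc ⌊log₂ m ⌋

extA : ℕ → List ℕ → List ℕ
extA m as = 0 ∷ (as ++ [ m * m ])

gaps : List ℕ → List ℕ
gaps []           = []
gaps (_ ∷ [])     = []
gaps (x ∷ y ∷ xs) = (y ∸ x) ∷ gaps (y ∷ xs)

Tstr : ℕ → List ℕ → List ℕ
Tstr m as = concat (zipWith (λ i g → concat (replicate g ((i % 2) ∷ ebin (kOf m) i)))
                            (upTo (suc m)) (gaps (extA m as)))

bOf : ℕ → List ℕ → ℕ
bOf m as = count (λ j → lexLt (suffix T j) (replicate (suc (kOf m)) 1 ++ [ 0 ]))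
                 (positions (length T))
  where T = Tstr m as

-- Write v_j = |{a ∈ A : a < j}|.  Unfolding the run lengths, T is the concatenation over j = 1, …, m²
-- of the blocks (v_j mod 2) · ebin_k(v_j), where v is nondecreasing and v_j ≤ m < 2^k.  A suffix of T
-- that does not start at an ebin either begins with 0 or with at most k ones followed by 0, and then lies
-- below the marker 1^{k+1}0, or it is 1 · ebin_k(v) · …, which lies above every suffix starting at an
-- ebin.  Suffixes starting at an ebin lie above the marker and are ordered by their value v, since bin_k
-- is order preserving below 2^k.  So the sorted suffixes are the b suffixes below the marker, then the m²
-- ebin suffixes sorted by v_j (in some order among equal values), then the rest; the (b + x)-th one
-- starts at the ebin of a block of value v_x, and the BWT reads the bit before it, v_x mod 2.

module Submission where

open import Defs
open import Data.Bool using (Bool; true; false; if_then_else_)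
open import Data.List
  using (List; []; _∷_; _++_; [_]; map; length; applyUpTo; upTo; drop; replicate; filter; concat; zipWith)
open import Data.List.Properties
  using (++-assoc; ++-identityʳ; length-++; length-map; length-upTo; length-replicate; length-drop; length-filter;
         map-++; map-∘; map-applyUpTo; map-cong-local; map-replicate; concat-++; filter-accept; filter-none)
open import Data.List.Membership.Propositional using (_∈_)
open import Data.List.Membership.Propositional.Properties using (∈-map⁻; ∈-map⁺; ∈-++⁻)
open import Data.List.Relation.Unary.All as All using (All; []; _∷_)
open import Data.List.Relation.Unary.All.Properties using (++⁺; replicate⁺; map⁺)
open import Data.List.Relation.Unary.AllPairs using (AllPairs; []; _∷_)
open import Data.List.Relation.Unary.Any using (here; there)
open import Data.List.Relation.Unary.Linked using (Linked)
open import Data.List.Relation.Unary.Linked.Properties using (Linked⇒AllPairs)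
open import Data.List.Relation.Unary.Unique.Propositional using (Unique)
open import Data.List.Relation.Binary.Permutation.Propositional
  using (_↭_; refl; prep; swap; trans; ↭-sym; module PermutationReasoning)
open import Data.List.Relation.Binary.Permutation.Propositional.Properties using (++⁺ˡ; shift; ↭-length; ∈-resp-↭)
open import Data.List.Relation.Binary.Sublist.Propositional using (⊆-refl)
open import Data.List.Relation.Binary.Sublist.Propositional.Properties using (filter⁺; length-mono-≤)
open import Data.Maybe using (Maybe; just)
open import Data.Nat using (ℕ; zero; suc; _+_; _∸_; _*_; _^_; _≤_; _<_; _<ᵇ_; _≡ᵇ_; z≤n; s≤s; z<s; s<s)
open import Data.Nat.DivMod using (_/_; _%_; m≡m%n+[m/n]*n; m%n<n; /-monoˡ-≤; m<n*o⇒m/o<n)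
open import Data.Nat.Logarithm using (⌊log₂_⌋; ⌊log₂⌋-mono-≤; ⌊log₂[2^n]⌋≡n)
open import Data.Nat.Properties
open import Data.Product using (_×_; _,_; proj₁; proj₂; ∃-syntax)
open import Data.Sum using (_⊎_; inj₁; inj₂)
import Data.Sum as Sum
open import Function using (_∘_; id)
open import Relation.Nullary using (contradiction)
open import Relation.Binary.Definitions using (tri<; tri≈; tri>)
open import Relation.Binary.PropositionalEquality
  using (_≡_; _≢_; refl; sym; cong; cong₂; subst; subst₂; module ≡-Reasoning)
  renaming (trans to ≡-trans)

<ᵇ≡true⇒< : ∀ m n → (m <ᵇ n) ≡ true → m < n
<ᵇ≡true⇒< zero    (suc n) _ = z<s
<ᵇ≡true⇒< (suc m) (suc n) h = s<s (<ᵇ≡true⇒< m n h)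

<⇒<ᵇ≡true : ∀ {m n} → m < n → (m <ᵇ n) ≡ true
<⇒<ᵇ≡true                 z<s       = refl
<⇒<ᵇ≡true {suc m} {suc n} (s<s m<n) = <⇒<ᵇ≡true {m} {n} m<n

≥⇒<ᵇ≡false : ∀ {m n} → n ≤ m → (m <ᵇ n) ≡ false
≥⇒<ᵇ≡false                 z≤n       = refl
≥⇒<ᵇ≡false {suc m} {suc n} (s≤s n≤m) = ≥⇒<ᵇ≡false {m} {n} n≤m

≡ᵇ-refl : ∀ n → (n ≡ᵇ n) ≡ true
≡ᵇ-refl zero    = refl
≡ᵇ-refl (suc n) = ≡ᵇ-refl n

≡ᵇ≡true⇒≡ : ∀ m n → (m ≡ᵇ n) ≡ true → m ≡ n
≡ᵇ≡true⇒≡ zero    zero    _ = refl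
≡ᵇ≡true⇒≡ (suc m) (suc n) h = cong suc (≡ᵇ≡true⇒≡ m n h)

_≺_ : List ℕ → List ℕ → Set
s ≺ t = lexLt s t ≡ true

lexLt-∷-≡ : ∀ x xs ys → lexLt (x ∷ xs) (x ∷ ys) ≡ lexLt xs ys
lexLt-∷-≡ zero    xs ys = refl
lexLt-∷-≡ (suc x) xs ys = lexLt-∷-≡ x xs ys

lexLt-++ˡ : ∀ us xs ys → lexLt (us ++ xs) (us ++ ys) ≡ lexLt xs ys
lexLt-++ˡ []       xs ys = refl
lexLt-++ˡ (u ∷ us) xs ys = ≡-trans (lexLt-∷-≡ u (us ++ xs) (us ++ ys)) (lexLt-++ˡ us xs ys)

lexLt-irrefl : ∀ s → lexLt s s ≡ false
lexLt-irrefl []      = refl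
lexLt-irrefl (x ∷ s) = ≡-trans (lexLt-∷-≡ x s s) (lexLt-irrefl s)

≺-∷⁺ : ∀ {x y} xs ys → x < y → (x ∷ xs) ≺ (y ∷ ys)
≺-∷⁺                 xs ys z<s       = refl
≺-∷⁺ {suc x} {suc y} xs ys (s<s x<y) = ≺-∷⁺ {x} {y} xs ys x<y

≺-∷⁻ : ∀ x y {xs ys} → (x ∷ xs) ≺ (y ∷ ys) → x < y ⊎ (x ≡ y × xs ≺ ys)
≺-∷⁻ zero    zero    xs≺ys = inj₂ (refl , xs≺ys)
≺-∷⁻ zero    (suc y) _     = inj₁ z<s
≺-∷⁻ (suc x) (suc y) {xs} {ys} h =
  Sum.map s≤s (λ (x≡y , xs≺ys) → cong suc x≡y , xs≺ys) (≺-∷⁻ x y {xs} {ys} h)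

≺-trans : ∀ s t u → s ≺ t → t ≺ u → s ≺ u
≺-trans []      (_ ∷ _) (_ ∷ _) _   _   = refl
≺-trans (x ∷ s) (y ∷ t) (z ∷ u) s≺t t≺u with ≺-∷⁻ x y {s} {t} s≺t | ≺-∷⁻ y z {t} {u} t≺u
... | inj₁ x<y            | inj₁ y<z            = ≺-∷⁺ s u (<-trans x<y y<z)
... | inj₁ x<y            | inj₂ (refl , _)     = ≺-∷⁺ s u x<y
... | inj₂ (refl , _)     | inj₁ y<z            = ≺-∷⁺ s u y<z
... | inj₂ (refl , s≺t′)  | inj₂ (refl , t≺u′)  =
  ≡-trans (lexLt-∷-≡ x s u) (≺-trans s t u s≺t′ t≺u′)

≺-asym : ∀ s t → s ≺ t → lexLt t s ≡ false
≺-asym s t s≺t with lexLt t s in t≺s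
... | false = refl
... | true  = contradiction (≡-trans (sym (≺-trans s t s s≺t t≺s)) (lexLt-irrefl s)) λ ()

≺-cmp : ∀ s t → s ≺ t ⊎ s ≡ t ⊎ t ≺ s
≺-cmp []      []      = inj₂ (inj₁ refl)
≺-cmp []      (_ ∷ _) = inj₁ refl
≺-cmp (_ ∷ _) []      = inj₂ (inj₂ refl)
≺-cmp (x ∷ s) (y ∷ t) with <-cmp x y
... | tri< x<y _ _ = inj₁ (≺-∷⁺ s t x<y)
... | tri> _ _ y<x = inj₂ (inj₂ (≺-∷⁺ t s y<x))
... | tri≈ _ refl _ with ≺-cmp s t
...   | inj₁ s≺t         = inj₁ (≡-trans (lexLt-∷-≡ x s t) s≺t)
...   | inj₂ (inj₁ refl) = inj₂ (inj₁ refl)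
...   | inj₂ (inj₂ t≺s)  = inj₂ (inj₂ (≡-trans (lexLt-∷-≡ x t s) t≺s))

tally : {A : Set} → (A → Bool) → List A → ℕ
tally p []       = 0
tally p (x ∷ xs) = if p x then suc (tally p xs) else tally p xs

module _ {A : Set} where

  tally-accept : ∀ (p : A → Bool) x xs → p x ≡ true → tally p (x ∷ xs) ≡ suc (tally p xs)
  tally-accept p x xs px rewrite px = refl

  tally-reject : ∀ (p : A → Bool) x xs → p x ≡ false → tally p (x ∷ xs) ≡ tally p xs
  tally-reject p x xs px rewrite px = refl

  tally-++ : ∀ (p : A → Bool) xs ys → tally p (xs ++ ys) ≡ tally p xs + tally p ys
  tally-++ p []       ys = refl
  tally-++ p (x ∷ xs) ys with p x
  ... | true  = cong suc (tally-++ p xs ys)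
  ... | false = tally-++ p xs ys

  tally-↭ : ∀ (p : A → Bool) {xs ys} → xs ↭ ys → tally p xs ≡ tally p ys
  tally-↭ p refl                = refl
  tally-↭ p (prep x xs↭ys)      = cong (λ n → if p x then suc n else n) (tally-↭ p xs↭ys)
  tally-↭ p (swap x y xs↭ys) with p x | p y
  ... | true  | true  = cong (suc ∘ suc) (tally-↭ p xs↭ys)
  ... | true  | false = cong suc (tally-↭ p xs↭ys)
  ... | false | true  = cong suc (tally-↭ p xs↭ys)
  ... | false | false = tally-↭ p xs↭ys
  tally-↭ p (trans xs↭ys ys↭zs) = ≡-trans (tally-↭ p xs↭ys) (tally-↭ p ys↭zs)

  tally-≤-length : ∀ (p : A → Bool) xs → tally p xs ≤ length xs
  tally-≤-length p []       = z≤n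
  tally-≤-length p (x ∷ xs) with p x
  ... | true  = s≤s (tally-≤-length p xs)
  ... | false = m≤n⇒m≤1+n (tally-≤-length p xs)

  tally-all : ∀ (p : A → Bool) xs → (∀ x → x ∈ xs → p x ≡ true) → tally p xs ≡ length xs
  tally-all p []       _  = refl
  tally-all p (x ∷ xs) px =
    ≡-trans (tally-accept p x xs (px x (here refl))) (cong suc (tally-all p xs (λ y → px y ∘ there)))

  tally-none : ∀ (p : A → Bool) xs → (∀ x → x ∈ xs → p x ≡ false) → tally p xs ≡ 0
  tally-none p []       _   = refl
  tally-none p (x ∷ xs) ¬px =
    ≡-trans (tally-reject p x xs (¬px x (here refl))) (tally-none p xs (λ y → ¬px y ∘ there))

  tally-cong : ∀ (p q : A → Bool) xs → (∀ x → x ∈ xs → p x ≡ q x) → tally p xs ≡ tally q xs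
  tally-cong p q []       _   = refl
  tally-cong p q (x ∷ xs) p≗q rewrite p≗q x (here refl) =
    cong (λ n → if q x then suc n else n) (tally-cong p q xs (λ y → p≗q y ∘ there))

  tally-mono : ∀ (p q : A → Bool) xs → (∀ x → x ∈ xs → p x ≡ true → q x ≡ true) →
               tally p xs ≤ tally q xs
  tally-mono p q []       _   = z≤n
  tally-mono p q (x ∷ xs) p⇒q with p x in px | q x in qx
  ... | true  | true  = s≤s (tally-mono p q xs (λ y → p⇒q y ∘ there))
  ... | true  | false with () ← ≡-trans (sym qx) (p⇒q x (here refl) px)
  ... | false | true  = m≤n⇒m≤1+n (tally-mono p q xs (λ y → p⇒q y ∘ there))
  ... | false | false = tally-mono p q xs (λ y → p⇒q y ∘ there)

  tally-mono-< : ∀ (p q : A → Bool) xs → (∀ x → x ∈ xs → p x ≡ true → q x ≡ true) →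
                 ∀ {y} → y ∈ xs → p y ≡ false → q y ≡ true → tally p xs < tally q xs
  tally-mono-< p q (x ∷ xs) p⇒q (here refl) px qx rewrite px | qx =
    s≤s (tally-mono p q xs (λ y → p⇒q y ∘ there))
  tally-mono-< p q (x ∷ xs) p⇒q (there y∈xs) py qy with p x in px | q x in qx
  ... | true  | true  = s≤s (tally-mono-< p q xs (λ z → p⇒q z ∘ there) y∈xs py qy)
  ... | true  | false with () ← ≡-trans (sym qx) (p⇒q x (here refl) px)
  ... | false | true  = m<n⇒m<1+n (tally-mono-< p q xs (λ z → p⇒q z ∘ there) y∈xs py qy)
  ... | false | false = tally-mono-< p q xs (λ z → p⇒q z ∘ there) y∈xs py qy

tally-map : ∀ {A B : Set} (p : B → Bool) (f : A → B) xs → tally p (map f xs) ≡ tally (p ∘ f) xs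
tally-map p f []       = refl
tally-map p f (x ∷ xs) = cong (λ n → if p (f x) then suc n else n) (tally-map p f xs)

count≡tally : ∀ (p : ℕ → Bool) xs → count p xs ≡ tally p xs
count≡tally p []       = refl
count≡tally p (x ∷ xs) = cong (λ n → if p x then suc n else n) (count≡tally p xs)

suffixes : {A : Set} → List A → List (List A)
suffixes []       = []
suffixes (x ∷ xs) = (x ∷ xs) ∷ suffixes xs

module _ {A : Set} where

  suffixes-++ : ∀ (xs ys : List A) → suffixes (xs ++ ys) ≡ map (_++ ys) (suffixes xs) ++ suffixes ys
  suffixes-++ []       ys = refl
  suffixes-++ (x ∷ xs) ys = cong ((x ∷ xs ++ ys) ∷_) (suffixes-++ xs ys)

  length-suffixes : ∀ (xs : List A) → length (suffixes xs) ≡ length xs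
  length-suffixes []       = refl
  length-suffixes (x ∷ xs) = cong suc (length-suffixes xs)

  length-∈-suffixes : ∀ {t} (xs : List A) → t ∈ suffixes xs → length t ≤ length xs
  length-∈-suffixes (x ∷ xs) (here refl) = ≤-refl
  length-∈-suffixes (x ∷ xs) (there t∈)  = m≤n⇒m≤1+n (length-∈-suffixes xs t∈)

  ∈-suffixes-++ʳ : ∀ {t} (xs : List A) {ys} → t ∈ suffixes ys → t ∈ suffixes (xs ++ ys)
  ∈-suffixes-++ʳ []       t∈ = t∈
  ∈-suffixes-++ʳ (x ∷ xs) t∈ = there (∈-suffixes-++ʳ xs t∈)

  suffixes-unique : ∀ (xs : List A) → Unique (suffixes xs)
  suffixes-unique []       = []
  suffixes-unique (x ∷ xs) = All.tabulate longer ∷ suffixes-unique xs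
    where
    longer : ∀ {t} → t ∈ suffixes xs → x ∷ xs ≢ t
    longer t∈ refl = <-irrefl refl (length-∈-suffixes xs t∈)

  applyUpTo-drop : ∀ (xs : List A) → applyUpTo (λ i → drop i xs) (length xs) ≡ suffixes xs
  applyUpTo-drop []       = refl
  applyUpTo-drop (x ∷ xs) = cong ((x ∷ xs) ∷_) (applyUpTo-drop xs)

rankIn : List (List ℕ) → List ℕ → ℕ
rankIn ts s = tally (λ t → lexLt t s) ts

rankIn-mono : ∀ ts {s u} → s ≺ u → rankIn ts s ≤ rankIn ts u
rankIn-mono ts {s} {u} s≺u = tally-mono _ _ ts (λ t _ t≺s → ≺-trans t s u t≺s s≺u)

rankIn-mono-< : ∀ ts {s u} → s ∈ ts → s ≺ u → rankIn ts s < rankIn ts u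
rankIn-mono-< ts {s} {u} s∈ts s≺u =
  tally-mono-< _ _ ts (λ t _ t≺s → ≺-trans t s u t≺s s≺u) s∈ts (lexLt-irrefl s) s≺u

rankIn-attained : ∀ ts → Unique ts → ∀ {r} → r < length ts → ∃[ s ] s ∈ ts × rankIn ts s ≡ r
rankIn-attained (t ∷ ts) (t∉ts ∷ uniq) {r} r<1+n with <-cmp r (rankIn ts t)
... | tri≈ _ r≡ρ _ = t , here refl , ≡-trans (tally-reject _ t ts (lexLt-irrefl t)) (sym r≡ρ)
... | tri< r<ρ _ _ =
  let s , s∈ts , ρs≡r = rankIn-attained ts uniq (<-≤-trans r<ρ (tally-≤-length _ ts))
  in s , there s∈ts , ≡-trans (tally-reject _ t ts (t⊀ s ρs≡r)) ρs≡r
  where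
  t⊀ : ∀ s → rankIn ts s ≡ r → lexLt t s ≡ false
  t⊀ s ρs≡r with lexLt t s in t≺s
  ... | false = refl
  ... | true  = contradiction (subst (rankIn ts t ≤_) ρs≡r (rankIn-mono ts t≺s)) (<⇒≱ r<ρ)
rankIn-attained (t ∷ ts) (t∉ts ∷ uniq) {suc r} r<1+n | tri> _ _ ρ<1+r =
  let s , s∈ts , ρs≡r = rankIn-attained ts uniq (≤-pred r<1+n)
  in s , there s∈ts , ≡-trans (tally-accept _ t ts (t≺ s s∈ts ρs≡r)) (cong suc ρs≡r)
  where
  t≺ : ∀ s → s ∈ ts → rankIn ts s ≡ r → t ≺ s
  t≺ s s∈ts ρs≡r with ≺-cmp t s
  ... | inj₁ t≺s         = t≺s
  ... | inj₂ (inj₁ refl) = contradiction refl (All.lookup t∉ts s∈ts)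
  ... | inj₂ (inj₂ s≺t)  =
    contradiction (subst (_< rankIn ts t) ρs≡r (rankIn-mono-< ts s∈ts s≺t)) (≤⇒≯ (≤-pred ρ<1+r))

Bits : List ℕ → Set
Bits = All (_≤ 1)

bin-bits : ∀ k v → Bits (bin k v)
bin-bits zero    v = []
bin-bits (suc k) v = ++⁺ (bin-bits k (v / 2)) (≤-pred (m%n<n v 2) ∷ [])

length-bin : ∀ k v → length (bin k v) ≡ k
length-bin zero    v = refl
length-bin (suc k) v =
  ≡-trans (length-++ (bin k (v / 2))) (≡-trans (cong (_+ 1) (length-bin k (v / 2))) (+-comm k 1))

m/2≡n/2⇒m<n⇒m%2<n%2 : ∀ {m n} → m / 2 ≡ n / 2 → m < n → m % 2 < n % 2
m/2≡n/2⇒m<n⇒m%2<n%2 {m} {n} m/2≡n/2 m<n = +-cancelʳ-< ((n / 2) * 2) (m % 2) (n % 2) (subst₂ _<_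
  (≡-trans (m≡m%n+[m/n]*n m 2) (cong (λ q → m % 2 + q * 2) m/2≡n/2)) (m≡m%n+[m/n]*n n 2) m<n)

bin-≺ : ∀ k {v v′} X Y → v < v′ → v′ < 2 ^ k → (bin k v ++ X) ≺ (bin k v′ ++ Y)
bin-≺ zero    X Y v<v′ (s≤s z≤n) with () ← v<v′
bin-≺ (suc k) {v} {v′} X Y v<v′ v′<2^1+k
  rewrite ++-assoc (bin k (v / 2)) [ v % 2 ] X | ++-assoc (bin k (v′ / 2)) [ v′ % 2 ] Y
  with m≤n⇒m<n∨m≡n (/-monoˡ-≤ 2 (<⇒≤ v<v′))
... | inj₁ v/2<v′/2 =
  bin-≺ k _ _ v/2<v′/2 (m<n*o⇒m/o<n {v′} {2 ^ k} {2} (subst (v′ <_) (*-comm 2 (2 ^ k)) v′<2^1+k))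
... | inj₂ v/2≡v′/2 rewrite v/2≡v′/2 | lexLt-++ˡ (bin k (v′ / 2)) (v % 2 ∷ X) (v′ % 2 ∷ Y) =
  ≺-∷⁺ X Y (m/2≡n/2⇒m<n⇒m%2<n%2 v/2≡v′/2 v<v′)

marker : ℕ → List ℕ
marker k = replicate (suc k) 1 ++ [ 0 ]

markerCount : ℕ → List ℕ → ℕ
markerCount k S = count (λ j → lexLt (suffix S j) (marker k)) (positions (length S))

short-run-≺-marker : ∀ k u Y → Bits u → length u ≤ k → (u ++ 0 ∷ Y) ≺ marker k
short-run-≺-marker k       []                Y _              _           = refl
short-run-≺-marker k       (0 ∷ u)           Y _              _           = refl
short-run-≺-marker (suc k) (1 ∷ u)           Y (_ ∷ u-bits)   (s≤s |u|≤k) =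
  ≡-trans (lexLt-∷-≡ 1 (u ++ 0 ∷ Y) (marker k)) (short-run-≺-marker k u Y u-bits |u|≤k)
short-run-≺-marker k       (suc (suc _) ∷ u) Y (s≤s () ∷ _) _

BelowMarker : ℕ → List ℕ → Set
BelowMarker k t = ∀ X → (t ++ X) ≺ marker k

suffixes-short-run-below : ∀ k u Y → Bits u → length u ≤ k → (∀ t → t ∈ suffixes Y → BelowMarker k t) →
                           ∀ t → t ∈ suffixes (u ++ 0 ∷ Y) → BelowMarker k t
suffixes-short-run-below k []      Y _ _ _       t (here refl) X = refl
suffixes-short-run-below k []      Y _ _ below-Y t (there t∈)    = below-Y t t∈
suffixes-short-run-below k (d ∷ u) Y du-bits |du|≤k _ t (here refl) X =
  subst (_≺ marker k) (sym (++-assoc (d ∷ u) (0 ∷ Y) X)) (short-run-≺-marker k (d ∷ u) (Y ++ X) du-bits |du|≤k)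
suffixes-short-run-below k (d ∷ u) Y (_ ∷ u-bits) |du|≤k below-Y t (there t∈) =
  suffixes-short-run-below k u Y u-bits (<⇒≤ |du|≤k) below-Y t t∈

-- ebin k v reduces to 1 ∷ ebinTail k v.
ebinTail : ℕ → ℕ → List ℕ
ebinTail k v = replicate k 1 ++ 0 ∷ bin k v ++ [ 0 ]

suffixes-ebinTail-below : ∀ k v t → t ∈ suffixes (ebinTail k v) → BelowMarker k t
suffixes-ebinTail-below k v =
  suffixes-short-run-below k (replicate k 1) (bin k v ++ [ 0 ])
    (replicate⁺ k (s≤s z≤n)) (≤-reflexive (length-replicate k))
    (suffixes-short-run-below k (bin k v) [] (bin-bits k v) (≤-reflexive (length-bin k v)) (λ _ ()))

ebin-++ : ∀ k v X → ebin k v ++ X ≡ replicate (suc k) 1 ++ 0 ∷ bin k v ++ 0 ∷ X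
ebin-++ k v X = ≡-trans (++-assoc (replicate (suc k) 1) (0 ∷ bin k v ++ [ 0 ]) X)
                        (cong (λ Z → replicate (suc k) 1 ++ 0 ∷ Z) (++-assoc (bin k v) [ 0 ] X))

[]-≺-++-∷ : ∀ ys y zs → [] ≺ (ys ++ y ∷ zs)
[]-≺-++-∷ []      y zs = refl
[]-≺-++-∷ (_ ∷ _) y zs = refl

marker-≺-ebin : ∀ k v X → marker k ≺ (ebin k v ++ X)
marker-≺-ebin k v X = begin
  lexLt (marker k) (ebin k v ++ X)
    ≡⟨ cong (lexLt (marker k)) (ebin-++ k v X) ⟩
  lexLt (replicate (suc k) 1 ++ [ 0 ]) (replicate (suc k) 1 ++ 0 ∷ bin k v ++ 0 ∷ X)
    ≡⟨ lexLt-++ˡ (replicate (suc k) 1) [ 0 ] _ ⟩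
  lexLt [] (bin k v ++ 0 ∷ X)
    ≡⟨ []-≺-++-∷ (bin k v) 0 X ⟩
  true ∎
  where open ≡-Reasoning

ones-0-≺-ones : ∀ n Z W → (replicate n 1 ++ 0 ∷ Z) ≺ (replicate (suc n) 1 ++ W)
ones-0-≺-ones zero    Z W = refl
ones-0-≺-ones (suc n) Z W =
  ≡-trans (lexLt-∷-≡ 1 (replicate n 1 ++ 0 ∷ Z) (replicate (suc n) 1 ++ W)) (ones-0-≺-ones n Z W)

ebin-≺-1∷ebin : ∀ k v X v′ Y → (ebin k v ++ X) ≺ (1 ∷ ebin k v′ ++ Y)
ebin-≺-1∷ebin k v X v′ Y =
  subst₂ _≺_ (sym (ebin-++ k v X)) (cong (1 ∷_) (sym (++-assoc (replicate (suc k) 1) _ Y)))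
         (ones-0-≺-ones (suc k) _ _)

marker-≺-1∷ebin : ∀ k v X → marker k ≺ (1 ∷ ebin k v ++ X)
marker-≺-1∷ebin k v X =
  ≺-trans (marker k) (ebin k v ++ X) (1 ∷ ebin k v ++ X) (marker-≺-ebin k v X) (ebin-≺-1∷ebin k v X v X)

ebin-≺-ebin : ∀ k {v v′} X Y → v < v′ → v′ < 2 ^ k → (ebin k v ++ X) ≺ (ebin k v′ ++ Y)
ebin-≺-ebin k {v} {v′} X Y v<v′ v′<2^k = begin
  lexLt (ebin k v ++ X) (ebin k v′ ++ Y)
    ≡⟨ cong₂ lexLt (ebin-++ k v X) (ebin-++ k v′ Y) ⟩
  lexLt (replicate (suc k) 1 ++ 0 ∷ bin k v ++ 0 ∷ X) (replicate (suc k) 1 ++ 0 ∷ bin k v′ ++ 0 ∷ Y)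
    ≡⟨ lexLt-++ˡ (replicate (suc k) 1) _ _ ⟩
  lexLt (bin k v ++ 0 ∷ X) (bin k v′ ++ 0 ∷ Y)
    ≡⟨ bin-≺ k (0 ∷ X) (0 ∷ Y) v<v′ v′<2^k ⟩
  true ∎
  where open ≡-Reasoning

interval : ℕ → ℕ → List ℕ
interval e zero    = []
interval e (suc d) = suc e ∷ interval (suc e) d

length-interval : ∀ e d → length (interval e d) ≡ d
length-interval e zero    = refl
length-interval e (suc d) = cong suc (length-interval (suc e) d)

∈-interval⁻ : ∀ {j} e d → j ∈ interval e d → e < j × j ≤ e + d
∈-interval⁻ e (suc d) (here refl) = ≤-refl , subst (suc e ≤_) (sym (+-suc e d)) (s≤s (m≤m+n e d))
∈-interval⁻ {j} e (suc d) (there j∈) with ∈-interval⁻ (suc e) d j∈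
... | e<j , j≤1+e+d = <-trans (n<1+n e) e<j , subst (j ≤_) (sym (+-suc e d)) j≤1+e+d

interval-++ : ∀ e d₁ d₂ → interval e d₁ ++ interval (e + d₁) d₂ ≡ interval e (d₁ + d₂)
interval-++ e zero     d₂ = cong (λ e′ → interval e′ d₂) (+-identityʳ e)
interval-++ e (suc d₁) d₂ =
  cong (suc e ∷_) (≡-trans (cong (λ e′ → interval (suc e) d₁ ++ interval e′ d₂) (+-suc e d₁))
                           (interval-++ (suc e) d₁ d₂))

interval-split : ∀ {e x M} → e ≤ x → x ≤ M → interval e (x ∸ e) ++ interval x (M ∸ x) ≡ interval e (M ∸ e)
interval-split {e} {x} {M} e≤x x≤M = begin
  interval e (x ∸ e) ++ interval x (M ∸ x)
    ≡⟨ cong (λ x′ → interval e (x ∸ e) ++ interval x′ (M ∸ x)) (sym (m+[n∸m]≡n e≤x)) ⟩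
  interval e (x ∸ e) ++ interval (e + (x ∸ e)) (M ∸ x)
    ≡⟨ interval-++ e (x ∸ e) (M ∸ x) ⟩
  interval e ((x ∸ e) + (M ∸ x))
    ≡⟨ cong (interval e) (sym (+-∸-comm (M ∸ x) e≤x)) ⟩
  interval e ((x + (M ∸ x)) ∸ e)
    ≡⟨ cong (λ M′ → interval e (M′ ∸ e)) (m+[n∸m]≡n x≤M) ⟩
  interval e (M ∸ e) ∎
  where open ≡-Reasoning

positions≡interval : ∀ n → positions n ≡ interval 0 n
positions≡interval n = map-suc-applyUpTo id 0 n (λ _ → refl)
  where
  map-suc-applyUpTo : ∀ (f : ℕ → ℕ) e n → (∀ i → f i ≡ e + i) → map suc (applyUpTo f n) ≡ interval e n
  map-suc-applyUpTo f e zero    _    = refl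
  map-suc-applyUpTo f e (suc n) f≗e+ =
    cong₂ _∷_ (cong suc (≡-trans (f≗e+ 0) (+-identityʳ e)))
              (map-suc-applyUpTo (f ∘ suc) (suc e) n (λ i → ≡-trans (f≗e+ (suc i)) (+-suc e i)))

tally-<ᵇ-positions : ∀ {n M} → n ≤ M → tally (_<ᵇ suc n) (positions M) ≡ n
tally-<ᵇ-positions {n} {M} n≤M = begin
  tally (_<ᵇ suc n) (positions M)
    ≡⟨ cong (tally (_<ᵇ suc n)) (≡-trans (positions≡interval M) (sym (interval-split z≤n n≤M))) ⟩
  tally (_<ᵇ suc n) (interval 0 n ++ interval n (M ∸ n))
    ≡⟨ tally-++ (_<ᵇ suc n) (interval 0 n) _ ⟩
  tally (_<ᵇ suc n) (interval 0 n) + tally (_<ᵇ suc n) (interval n (M ∸ n))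
    ≡⟨ cong₂ _+_ (tally-all _ _ (λ j j∈ → <⇒<ᵇ≡true (s≤s (proj₂ (∈-interval⁻ 0 n j∈)))))
                 (tally-none _ _ (λ j j∈ → ≥⇒<ᵇ≡false (proj₁ (∈-interval⁻ n (M ∸ n) j∈)))) ⟩
  length (interval 0 n) + 0
    ≡⟨ ≡-trans (+-identityʳ _) (length-interval 0 n) ⟩
  n ∎
  where open ≡-Reasoning

monotone-value-from-counts : ∀ (c : ℕ → ℕ) → (∀ {i j} → i ≤ j → c i ≤ c j) →
                             ∀ {M n v} → suc n ≤ M →
                             tally (_<ᵇ v) (map c (positions M)) ≤ n →
                             n < tally (_<ᵇ suc v) (map c (positions M)) →
                             v ≡ c (suc n)
monotone-value-from-counts c c-mono {M} {n} {v} n<M lower upper with <-cmp v (c (suc n))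
... | tri≈ _ v≡c _ = v≡c
... | tri< v<c _ _ = contradiction upper (≤⇒≯ (begin
  tally (_<ᵇ suc v) (map c (positions M))   ≡⟨ tally-map _ c (positions M) ⟩
  tally (λ j → c j <ᵇ suc v) (positions M)  ≤⟨ tally-mono _ _ (positions M) (λ j _ → at-most-n j) ⟩
  tally (_<ᵇ suc n) (positions M)           ≡⟨ tally-<ᵇ-positions (<⇒≤ n<M) ⟩
  n                                         ∎))
  where
  open ≤-Reasoning
  at-most-n : ∀ j → (c j <ᵇ suc v) ≡ true → (j <ᵇ suc n) ≡ true
  at-most-n j cj≤v = <⇒<ᵇ≡true (s≤s (≮⇒≥ λ n<j →
    <⇒≱ v<c (≤-trans (c-mono n<j) (≤-pred (<ᵇ≡true⇒< (c j) (suc v) cj≤v)))))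
... | tri> _ _ c<v = contradiction lower (<⇒≱ (begin-strict
  n                                         <⟨ n<1+n n ⟩
  suc n                                     ≡⟨ sym (tally-<ᵇ-positions n<M) ⟩
  tally (_<ᵇ suc (suc n)) (positions M)     ≤⟨ tally-mono _ _ (positions M) (λ j _ → below-v j) ⟩
  tally (λ j → c j <ᵇ v) (positions M)      ≡⟨ sym (tally-map _ c (positions M)) ⟩
  tally (_<ᵇ v) (map c (positions M))       ∎))
  where
  open ≤-Reasoning
  below-v : ∀ j → (j <ᵇ suc (suc n)) ≡ true → (c j <ᵇ v) ≡ true
  below-v j j≤1+n = <⇒<ᵇ≡true (≤-<-trans (c-mono (≤-pred (<ᵇ≡true⇒< j (suc (suc n)) j≤1+n))) c<v)

map-suffix-positions : ∀ S → map (suffix S) (positions (length S)) ≡ suffixes S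
map-suffix-positions S = begin
  map (suffix S) (map suc (upTo (length S)))  ≡⟨ sym (map-∘ (upTo (length S))) ⟩
  map (λ i → drop i S) (upTo (length S))      ≡⟨ map-applyUpTo id (λ i → drop i S) (length S) ⟩
  applyUpTo (λ i → drop i S) (length S)       ≡⟨ applyUpTo-drop S ⟩
  suffixes S                                  ∎
  where open ≡-Reasoning

count-suffix≡tally : ∀ S (g : List ℕ → Bool) →
                     count (g ∘ suffix S) (positions (length S)) ≡ tally g (suffixes S)
count-suffix≡tally S g = begin
  count (g ∘ suffix S) (positions (length S))      ≡⟨ count≡tally _ (positions (length S)) ⟩
  tally (g ∘ suffix S) (positions (length S))      ≡⟨ sym (tally-map g (suffix S) (positions (length S))) ⟩
  tally g (map (suffix S) (positions (length S)))  ≡⟨ cong (tally g) (map-suffix-positions S) ⟩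
  tally g (suffixes S)                             ∎
  where open ≡-Reasoning

rank≡rankIn : ∀ S q → rank S q ≡ rankIn (suffixes S) (suffix S q)
rank≡rankIn S q = count-suffix≡tally S (λ t → lexLt t (suffix S q))

markerCount≡rankIn : ∀ k S → markerCount k S ≡ rankIn (suffixes S) (marker k)
markerCount≡rankIn k S = count-suffix≡tally S (λ t → lexLt t (marker k))

∈-suffixes⁻ : ∀ {t} (S : List ℕ) → t ∈ suffixes S → ∃[ i ] i < length S × drop i S ≡ t
∈-suffixes⁻ (x ∷ S) (here refl) = 0 , z<s , refl
∈-suffixes⁻ (x ∷ S) (there t∈) with i , i<n , drop≡t ← ∈-suffixes⁻ S t∈ = suc i , s<s i<n , drop≡t

drop-suc-∷ : ∀ i (S : List ℕ) {c t} → drop i S ≡ c ∷ t → drop (suc i) S ≡ t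
drop-suc-∷ zero    (x ∷ S) refl = refl
drop-suc-∷ (suc i) (x ∷ S) eq   = drop-suc-∷ i S eq

at-suc-drop : ∀ i (S : List ℕ) {c t} → drop i S ≡ c ∷ t → at S (suc i) ≡ just c
at-suc-drop zero    (x ∷ S) refl = refl
at-suc-drop (suc i) (x ∷ S) eq   = at-suc-drop i S eq

drop-injective : ∀ {i j} (S : List ℕ) → i ≤ length S → j ≤ length S → drop i S ≡ drop j S → i ≡ j
drop-injective {i} {j} S i≤ j≤ eq =
  ∸-cancelˡ-≡ i≤ j≤ (≡-trans (sym (length-drop i S)) (≡-trans (cong length eq) (length-drop j S)))

bwtChar-preceding : ∀ S {q c} → q ∈ positions (length S) → (c ∷ suffix S q) ∈ suffixes S →
                    bwtChar S q ≡ just c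
bwtChar-preceding S {q} q∈ c∷q∈
  with ∈-interval⁻ 0 (length S) (subst (q ∈_) (positions≡interval (length S)) q∈) | ∈-suffixes⁻ S c∷q∈
... | s≤s _ , q≤n | i , i<n , drop≡ with refl ← drop-injective S i<n (<⇒≤ q≤n) (drop-suc-∷ i S drop≡) =
  at-suc-drop i S drop≡

bindM-findFirst : ∀ (p : ℕ → Bool) (g : ℕ → Maybe ℕ) {z} xs → ∃[ q ] q ∈ xs × p q ≡ true →
                  (∀ {q} → q ∈ xs → p q ≡ true → g q ≡ just z) → bindM (findFirst p xs) g ≡ just z
bindM-findFirst p g (y ∷ ys) (q , q∈ , pq) found with p y in py
... | true = found (here refl) py
... | false with q∈
...   | here refl  = contradiction (≡-trans (sym pq) py) λ ()
...   | there q∈ys = bindM-findFirst p g ys (q , q∈ys , pq) (found ∘ there)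

rank-attained : ∀ S {r} → r < length S → ∃[ q ] q ∈ positions (length S) × rank S q ≡ r
rank-attained S {r} r<n
  with s , s∈ , rank-s ← rankIn-attained (suffixes S) (suffixes-unique S) (subst (r <_) (sym (length-suffixes S)) r<n)
  with q , q∈ , refl ← ∈-map⁻ (suffix S) (subst (s ∈_) (sym (map-suffix-positions S)) s∈)
  = q , q∈ , ≡-trans (rank≡rankIn S q) rank-s

BWT-at-rank : ∀ S {r z} → r < length S →
              (∀ {q} → q ∈ positions (length S) → rank S q ≡ r → bwtChar S q ≡ just z) →
              BWT S (suc r) ≡ just z
BWT-at-rank S {r} r<n char with q , q∈ , refl ← rank-attained S r<n =
  bindM-findFirst _ (bwtChar S) (positions (length S)) (q , q∈ , ≡ᵇ-refl (rank S q))
                  (λ q∈ h → char q∈ (≡ᵇ≡true⇒≡ _ _ h))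

module Encoding (k : ℕ) where

  block : ℕ → List ℕ
  block v = v % 2 ∷ ebin k v

  encode : List ℕ → List ℕ
  encode vs = concat (map block vs)

  blocks : List ℕ → List (ℕ × List ℕ)
  blocks []       = []
  blocks (v ∷ vs) = (v , encode vs) ∷ blocks vs

  ebinSuffixes : List ℕ → List (List ℕ)
  ebinSuffixes vs = map (λ (v , X) → ebin k v ++ X) (blocks vs)

  nonEbinSuffixes : List ℕ → List (List ℕ)
  nonEbinSuffixes []       = []
  nonEbinSuffixes (v ∷ vs) =
    (block v ++ encode vs) ∷ map (_++ encode vs) (suffixes (ebinTail k v)) ++ nonEbinSuffixes vs

  suffixes-encode-↭ : ∀ vs → suffixes (encode vs) ↭ nonEbinSuffixes vs ++ ebinSuffixes vs
  suffixes-encode-↭ []       = refl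
  suffixes-encode-↭ (v ∷ vs) = begin
    B ∷ H ∷ suffixes (ebinTail k v ++ X)  ≡⟨ cong (λ ts → B ∷ H ∷ ts) (suffixes-++ (ebinTail k v) X) ⟩
    B ∷ H ∷ (I ++ suffixes X)             ↭⟨ prep B (prep H (++⁺ˡ I (suffixes-encode-↭ vs))) ⟩
    B ∷ H ∷ (I ++ N ++ E)                 ≡⟨ cong (λ ts → B ∷ H ∷ ts) (sym (++-assoc I N E)) ⟩
    B ∷ H ∷ ((I ++ N) ++ E)               ↭⟨ prep B (↭-sym (shift H (I ++ N) E)) ⟩
    B ∷ ((I ++ N) ++ H ∷ E)               ∎
    where
    open PermutationReasoning
    X = encode vs
    B = block v ++ X
    H = ebin k v ++ X
    I = map (_++ X) (suffixes (ebinTail k v))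
    N = nonEbinSuffixes vs
    E = ebinSuffixes vs

  nonEbinSuffix-cases : ∀ vs {t} → t ∈ nonEbinSuffixes vs →
                        t ≺ marker k ⊎ ∃[ v ] ∃[ X ] t ≡ 1 ∷ ebin k v ++ X
  nonEbinSuffix-cases (v ∷ vs) (here refl) with v % 2 | m%n<n v 2
  ... | 0           | _ = inj₁ refl
  ... | 1           | _ = inj₂ (v , encode vs , refl)
  ... | suc (suc _) | s≤s (s≤s ())
  nonEbinSuffix-cases (v ∷ vs) (there t∈) with ∈-++⁻ (map (_++ encode vs) (suffixes (ebinTail k v))) t∈
  ... | inj₁ t∈I with u , u∈ , refl ← ∈-map⁻ (_++ encode vs) t∈I =
    inj₁ (suffixes-ebinTail-below k v u u∈ (encode vs))
  ... | inj₂ t∈N = nonEbinSuffix-cases vs t∈N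

  ∈-blocks⁻ : ∀ {v X} vs → (v , X) ∈ blocks vs → v ∈ vs
  ∈-blocks⁻ (w ∷ ws) (here refl) = here refl
  ∈-blocks⁻ (w ∷ ws) (there vX∈) = there (∈-blocks⁻ ws vX∈)

  block-∈-suffixes : ∀ {v X} vs → (v , X) ∈ blocks vs → (v % 2 ∷ ebin k v ++ X) ∈ suffixes (encode vs)
  block-∈-suffixes (w ∷ ws) (here refl) = here refl
  block-∈-suffixes (w ∷ ws) (there vX∈) = ∈-suffixes-++ʳ (block w) (block-∈-suffixes ws vX∈)

  tally-blocks : ∀ (p : ℕ → Bool) vs → tally (p ∘ proj₁) (blocks vs) ≡ tally p vs
  tally-blocks p []       = refl
  tally-blocks p (v ∷ vs) = cong (λ n → if p v then suc n else n) (tally-blocks p vs)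

  length-ebinSuffixes : ∀ vs → length (ebinSuffixes vs) ≡ length vs
  length-ebinSuffixes []       = refl
  length-ebinSuffixes (v ∷ vs) = cong suc (length-ebinSuffixes vs)

  markerRank : List ℕ → ℕ
  markerRank vs = rankIn (suffixes (encode vs)) (marker k)

  rankIn-encode : ∀ vs s →
                  rankIn (suffixes (encode vs)) s ≡ rankIn (nonEbinSuffixes vs) s + rankIn (ebinSuffixes vs) s
  rankIn-encode vs s =
    ≡-trans (tally-↭ _ (suffixes-encode-↭ vs)) (tally-++ _ (nonEbinSuffixes vs) (ebinSuffixes vs))

  markerRank≡rankIn-nonEbin : ∀ vs → markerRank vs ≡ rankIn (nonEbinSuffixes vs) (marker k)
  markerRank≡rankIn-nonEbin vs = begin
    markerRank vs
      ≡⟨ rankIn-encode vs (marker k) ⟩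
    rankIn (nonEbinSuffixes vs) (marker k) + rankIn (ebinSuffixes vs) (marker k)
      ≡⟨ cong (rankIn (nonEbinSuffixes vs) (marker k) +_) (tally-none _ _ ebin-⊀-marker) ⟩
    rankIn (nonEbinSuffixes vs) (marker k) + 0
      ≡⟨ +-identityʳ _ ⟩
    rankIn (nonEbinSuffixes vs) (marker k) ∎
    where
    open ≡-Reasoning
    ebin-⊀-marker : ∀ t → t ∈ ebinSuffixes vs → lexLt t (marker k) ≡ false
    ebin-⊀-marker t t∈ with (v , X) , _ , refl ← ∈-map⁻ _ t∈ =
      ≺-asym (marker k) (ebin k v ++ X) (marker-≺-ebin k v X)

  rankIn-ebin : ∀ vs v Y → let s = ebin k v ++ Y in
                rankIn (suffixes (encode vs)) s ≡ markerRank vs + rankIn (ebinSuffixes vs) s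
  rankIn-ebin vs v Y = begin
    rankIn (suffixes (encode vs)) s
      ≡⟨ rankIn-encode vs s ⟩
    rankIn (nonEbinSuffixes vs) s + rankIn (ebinSuffixes vs) s
      ≡⟨ cong (_+ rankIn (ebinSuffixes vs) s) (tally-cong _ _ _ compare-like-marker) ⟩
    rankIn (nonEbinSuffixes vs) (marker k) + rankIn (ebinSuffixes vs) s
      ≡⟨ cong (_+ rankIn (ebinSuffixes vs) s) (sym (markerRank≡rankIn-nonEbin vs)) ⟩
    markerRank vs + rankIn (ebinSuffixes vs) s ∎
    where
    open ≡-Reasoning
    s = ebin k v ++ Y
    compare-like-marker : ∀ t → t ∈ nonEbinSuffixes vs → lexLt t s ≡ lexLt t (marker k)
    compare-like-marker t t∈ with nonEbinSuffix-cases vs t∈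
    ... | inj₁ t≺marker = ≡-trans (≺-trans t (marker k) s t≺marker (marker-≺-ebin k v Y)) (sym t≺marker)
    ... | inj₂ (v′ , X , refl) = ≡-trans (≺-asym s high (ebin-≺-1∷ebin k v Y v′ X))
                                         (sym (≺-asym (marker k) high (marker-≺-1∷ebin k v′ X)))
      where high = 1 ∷ ebin k v′ ++ X

  markerRank+length≤rankIn-1∷ebin : ∀ vs v Y →
                                    markerRank vs + length vs ≤ rankIn (suffixes (encode vs)) (1 ∷ ebin k v ++ Y)
  markerRank+length≤rankIn-1∷ebin vs v Y = begin
    markerRank vs + length vs
      ≡⟨ cong₂ _+_ (markerRank≡rankIn-nonEbin vs) (sym (length-ebinSuffixes vs)) ⟩
    rankIn (nonEbinSuffixes vs) (marker k) + length (ebinSuffixes vs)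
      ≤⟨ +-mono-≤ (rankIn-mono (nonEbinSuffixes vs) (marker-≺-1∷ebin k v Y))
                  (≤-reflexive (sym (tally-all _ _ ebin-≺))) ⟩
    rankIn (nonEbinSuffixes vs) s + rankIn (ebinSuffixes vs) s
      ≡⟨ sym (rankIn-encode vs s) ⟩
    rankIn (suffixes (encode vs)) s ∎
    where
    open ≤-Reasoning
    s = 1 ∷ ebin k v ++ Y
    ebin-≺ : ∀ t → t ∈ ebinSuffixes vs → t ≺ s
    ebin-≺ t t∈ with (v′ , X) , _ , refl ← ∈-map⁻ _ t∈ = ebin-≺-1∷ebin k v′ X v Y

  markerRank+length≤length : ∀ vs → markerRank vs + length vs ≤ length (encode vs)
  markerRank+length≤length vs = begin
    markerRank vs + length vs
      ≡⟨ cong₂ _+_ (markerRank≡rankIn-nonEbin vs) (sym (length-ebinSuffixes vs)) ⟩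
    rankIn (nonEbinSuffixes vs) (marker k) + length (ebinSuffixes vs)
      ≤⟨ +-monoˡ-≤ _ (tally-≤-length _ (nonEbinSuffixes vs)) ⟩
    length (nonEbinSuffixes vs) + length (ebinSuffixes vs)
      ≡⟨ sym (length-++ (nonEbinSuffixes vs)) ⟩
    length (nonEbinSuffixes vs ++ ebinSuffixes vs)
      ≡⟨ sym (↭-length (suffixes-encode-↭ vs)) ⟩
    length (suffixes (encode vs))
      ≡⟨ length-suffixes (encode vs) ⟩
    length (encode vs) ∎
    where open ≤-Reasoning

  count-smaller≤rankIn-ebin : ∀ vs {v₀} Y → v₀ < 2 ^ k →
                              tally (_<ᵇ v₀) vs ≤ rankIn (ebinSuffixes vs) (ebin k v₀ ++ Y)
  count-smaller≤rankIn-ebin vs {v₀} Y v₀<2^k = begin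
    tally (_<ᵇ v₀) vs                                        ≡⟨ sym (tally-blocks _ vs) ⟩
    tally ((_<ᵇ v₀) ∘ proj₁) (blocks vs)                     ≤⟨ tally-mono _ _ (blocks vs) smaller-≺ ⟩
    tally (λ (v , X) → lexLt (ebin k v ++ X) s) (blocks vs)  ≡⟨ sym (tally-map _ _ (blocks vs)) ⟩
    rankIn (ebinSuffixes vs) s                               ∎
    where
    open ≤-Reasoning
    s = ebin k v₀ ++ Y
    smaller-≺ : ∀ vX → vX ∈ blocks vs → (proj₁ vX <ᵇ v₀) ≡ true → (ebin k (proj₁ vX) ++ proj₂ vX) ≺ s
    smaller-≺ (v , X) _ v<v₀ = ebin-≺-ebin k X Y (<ᵇ≡true⇒< v v₀ v<v₀) v₀<2^k

  rankIn-ebin<count-≤ : ∀ vs {v₀ Y} → All (_< 2 ^ k) vs → (v₀ , Y) ∈ blocks vs →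
                        rankIn (ebinSuffixes vs) (ebin k v₀ ++ Y) < tally (_<ᵇ suc v₀) vs
  rankIn-ebin<count-≤ vs {v₀} {Y} vs<2^k v₀Y∈ = begin-strict
    rankIn (ebinSuffixes vs) s
      ≡⟨ tally-map _ _ (blocks vs) ⟩
    tally (λ (v , X) → lexLt (ebin k v ++ X) s) (blocks vs)
      <⟨ tally-mono-< _ _ (blocks vs) ≺-not-larger v₀Y∈ (lexLt-irrefl s) (<⇒<ᵇ≡true (n<1+n v₀)) ⟩
    tally ((_<ᵇ suc v₀) ∘ proj₁) (blocks vs)
      ≡⟨ tally-blocks _ vs ⟩
    tally (_<ᵇ suc v₀) vs ∎
    where
    open ≤-Reasoning
    s = ebin k v₀ ++ Y
    ≺-not-larger : ∀ vX → vX ∈ blocks vs → (ebin k (proj₁ vX) ++ proj₂ vX) ≺ s →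
                   (proj₁ vX <ᵇ suc v₀) ≡ true
    ≺-not-larger (v , X) vX∈ vX≺s = <⇒<ᵇ≡true (s≤s (≮⇒≥ λ v₀<v → contradiction
      (≡-trans (sym vX≺s) (≺-asym s (ebin k v ++ X) (ebin-≺-ebin k Y X v₀<v v<2^k))) λ ()))
      where
      v<2^k : v < 2 ^ k
      v<2^k = All.lookup vs<2^k (∈-blocks⁻ vs vX∈)

  ebinSuffix-of-rank : ∀ vs {s n} → s ∈ suffixes (encode vs) → n < length vs →
                       rankIn (suffixes (encode vs)) s ≡ markerRank vs + n →
                       ∃[ v₀ ] ∃[ Y ] (v₀ , Y) ∈ blocks vs × s ≡ ebin k v₀ ++ Y
                                      × rankIn (ebinSuffixes vs) (ebin k v₀ ++ Y) ≡ n
  ebinSuffix-of-rank vs {s} {n} s∈ n<len rank-s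
    with ∈-++⁻ (nonEbinSuffixes vs) (∈-resp-↭ (suffixes-encode-↭ vs) s∈)
  ... | inj₂ s∈E with (v₀ , Y) , v₀Y∈ , refl ← ∈-map⁻ _ s∈E =
    v₀ , Y , v₀Y∈ , refl , +-cancelˡ-≡ (markerRank vs) _ _ (≡-trans (sym (rankIn-ebin vs v₀ Y)) rank-s)
  ... | inj₁ s∈N with nonEbinSuffix-cases vs s∈N
  ...   | inj₁ s≺marker =
    contradiction (rankIn-mono-< (suffixes (encode vs)) s∈ s≺marker)
                  (≤⇒≯ (subst (markerRank vs ≤_) (sym rank-s) (m≤m+n (markerRank vs) n)))
  ...   | inj₂ (v , X , refl) =
    contradiction (markerRank+length≤rankIn-1∷ebin vs v X)
                  (<⇒≱ (subst (_< markerRank vs + length vs) (sym rank-s) (+-monoʳ-< (markerRank vs) n<len)))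

  module _ (c : ℕ → ℕ) (c-mono : ∀ {i j} → i ≤ j → c i ≤ c j) (c<2^k : ∀ j → c j < 2 ^ k) (M : ℕ) where

    private
      vs : List ℕ
      vs = map c (positions M)

      S : List ℕ
      S = encode vs

      length-vs : length vs ≡ M
      length-vs = ≡-trans (length-map c (positions M)) (≡-trans (length-map suc (upTo M)) (length-upTo M))

      vs<2^k : All (_< 2 ^ k) vs
      vs<2^k = map⁺ (All.universal c<2^k (positions M))

    bwtChar-at-rank : ∀ {n q} → suc n ≤ M → q ∈ positions (length S) → rank S q ≡ markerRank vs + n →
                      bwtChar S q ≡ just (c (suc n) % 2)
    bwtChar-at-rank {n} {q} n<M q∈ rank-q
      with v₀ , Y , v₀Y∈ , q↦ebin , rank-ebin ←
             ebinSuffix-of-rank vs (subst (suffix S q ∈_) (map-suffix-positions S) (∈-map⁺ (suffix S) q∈))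
                                (subst (n <_) (sym length-vs) n<M) (≡-trans (sym (rank≡rankIn S q)) rank-q)
      = begin
      bwtChar S q
        ≡⟨ bwtChar-preceding S q∈ (subst (λ t → (v₀ % 2 ∷ t) ∈ suffixes S) (sym q↦ebin)
                                         (block-∈-suffixes vs v₀Y∈)) ⟩
      just (v₀ % 2)
        ≡⟨ cong (λ v → just (v % 2)) v₀≡c[1+n] ⟩
      just (c (suc n) % 2) ∎
      where
      open ≡-Reasoning
      v₀≡c[1+n] : v₀ ≡ c (suc n)
      v₀≡c[1+n] = monotone-value-from-counts c c-mono n<M
        (subst (tally (_<ᵇ v₀) vs ≤_) rank-ebin
               (count-smaller≤rankIn-ebin vs Y (All.lookup vs<2^k (∈-blocks⁻ vs v₀Y∈))))
        (subst (_< tally (_<ᵇ suc v₀) vs) rank-ebin (rankIn-ebin<count-≤ vs vs<2^k v₀Y∈))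

    BWT-encode-monotone : ∀ n → suc n ≤ M → BWT S (markerCount k S + suc n) ≡ just (c (suc n) % 2)
    BWT-encode-monotone n n<M rewrite markerCount≡rankIn k S | +-suc (markerRank vs) n =
      BWT-at-rank S (<-≤-trans (+-monoʳ-< (markerRank vs) (subst (n <_) (sym length-vs) n<M))
                               (markerRank+length≤length vs))
                    (bwtChar-at-rank n<M)

map-const-on : ∀ {A B : Set} {g : A → B} {z} xs → All (λ x → g x ≡ z) xs → map g xs ≡ replicate (length xs) z
map-const-on []       []           = refl
map-const-on (x ∷ xs) (gx≡z ∷ g≡z) = cong₂ _∷_ gx≡z (map-const-on xs g≡z)

predCount : List ℕ → ℕ → ℕ
predCount A j = length (filter (_<? j) A)

predCount-mono : ∀ A {i j} → i ≤ j → predCount A i ≤ predCount A j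
predCount-mono A {i} {j} i≤j =
  length-mono-≤ (filter⁺ (_<? i) (_<? j) (λ { refl a<i → <-≤-trans a<i i≤j }) (⊆-refl {x = A}))

predCount-∷-< : ∀ {x j} A → x < j → predCount (x ∷ A) j ≡ suc (predCount A j)
predCount-∷-< {j = j} A x<j = cong length (filter-accept (_<? j) x<j)

predCount-≡0 : ∀ {j} A → All (j ≤_) A → predCount A j ≡ 0
predCount-≡0 {j} A j≤A = cong length (filter-none (_<? j) (All.map ≤⇒≯ j≤A))

predCount<2^kOf : ∀ m A → length A ≡ m → ∀ j → predCount A j < 2 ^ kOf m
predCount<2^kOf m A |A|≡m j = ≤-<-trans (≤-trans (length-filter (_<? j) A) (≤-reflexive |A|≡m)) m<2^k
  where
  m<2^k : m < 2 ^ kOf m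
  m<2^k = ≰⇒> λ 2^k≤m →
    <-irrefl refl (subst (_≤ ⌊log₂ m ⌋) (⌊log₂[2^n]⌋≡n (kOf m)) (⌊log₂⌋-mono-≤ 2^k≤m))

runs : List ℕ → List ℕ → List ℕ
runs is gs = concat (zipWith (λ i g → replicate g i) is gs)

concat-map-runs : ∀ {B : Set} (f : ℕ → List B) is gs →
                  concat (map f (runs is gs)) ≡ concat (zipWith (λ i g → concat (replicate g (f i))) is gs)
concat-map-runs f []       gs       = refl
concat-map-runs f (i ∷ is) []       = refl
concat-map-runs f (i ∷ is) (g ∷ gs) = begin
  concat (map f (replicate g i ++ runs is gs))
    ≡⟨ cong concat (map-++ f (replicate g i) (runs is gs)) ⟩
  concat (map f (replicate g i) ++ map f (runs is gs))
    ≡⟨ sym (concat-++ (map f (replicate g i)) (map f (runs is gs))) ⟩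
  concat (map f (replicate g i)) ++ concat (map f (runs is gs))
    ≡⟨ cong₂ (λ xs ys → concat xs ++ ys) (map-replicate f g i) (concat-map-runs f is gs) ⟩
  concat (replicate g (f i)) ++ concat (zipWith (λ i g → concat (replicate g (f i))) is gs) ∎
  where open ≡-Reasoning

runs-gaps : ∀ (f : ℕ → ℕ) {e M} A → AllPairs _<_ A → All (λ a → e < a × a ≤ M) A → e ≤ M →
            runs (applyUpTo f (suc (length A))) (gaps (e ∷ A ++ [ M ])) ≡ map (f ∘ predCount A) (interval e (M ∸ e))
runs-gaps f {e} {M} [] [] [] e≤M = begin
  replicate (M ∸ e) (f 0) ++ []
    ≡⟨ ++-identityʳ _ ⟩
  replicate (M ∸ e) (f 0)
    ≡⟨ cong (λ d → replicate d (f 0)) (sym (length-interval e (M ∸ e))) ⟩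
  replicate (length (interval e (M ∸ e))) (f 0)
    ≡⟨ sym (map-const-on _ (All.tabulate (λ _ → refl))) ⟩
  map (λ _ → f 0) (interval e (M ∸ e)) ∎
  where open ≡-Reasoning
runs-gaps f {e} {M} (x ∷ A) (x<A ∷ A-sorted) ((e<x , x≤M) ∷ A-bounded) e≤M = begin
  replicate (x ∸ e) (f 0) ++ runs (applyUpTo (f ∘ suc) (suc (length A))) (gaps (x ∷ A ++ [ M ]))
    ≡⟨ cong (replicate (x ∸ e) (f 0) ++_)
            (runs-gaps (f ∘ suc) A A-sorted (All.zip (x<A , All.map proj₂ A-bounded)) x≤M) ⟩
  replicate (x ∸ e) (f 0) ++ map (f ∘ suc ∘ predCount A) (interval x (M ∸ x))
    ≡⟨ cong₂ _++_ (sym up-to-x) (sym (map-cong-local (All.tabulate after-x))) ⟩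
  map g (interval e (x ∸ e)) ++ map g (interval x (M ∸ x))
    ≡⟨ sym (map-++ g (interval e (x ∸ e)) (interval x (M ∸ x))) ⟩
  map g (interval e (x ∸ e) ++ interval x (M ∸ x))
    ≡⟨ cong (map g) (interval-split (<⇒≤ e<x) x≤M) ⟩
  map g (interval e (M ∸ e)) ∎
  where
  open ≡-Reasoning
  g : ℕ → ℕ
  g = f ∘ predCount (x ∷ A)
  up-to-x : map g (interval e (x ∸ e)) ≡ replicate (x ∸ e) (f 0)
  up-to-x = ≡-trans (map-const-on (interval e (x ∸ e)) (All.tabulate none-below))
                    (cong (λ d → replicate d (f 0)) (length-interval e (x ∸ e)))
    where
    none-below : ∀ {j} → j ∈ interval e (x ∸ e) → g j ≡ f 0
    none-below {j} j∈ = cong f (predCount-≡0 (x ∷ A) (j≤x ∷ All.map (λ x<a → ≤-trans j≤x (<⇒≤ x<a)) x<A))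
      where
      j≤x : j ≤ x
      j≤x = subst (j ≤_) (m+[n∸m]≡n (<⇒≤ e<x)) (proj₂ (∈-interval⁻ e (x ∸ e) j∈))
  after-x : ∀ {j} → j ∈ interval x (M ∸ x) → g j ≡ f (suc (predCount A j))
  after-x j∈ = cong f (predCount-∷-< A (proj₁ (∈-interval⁻ x (M ∸ x) j∈)))

Tstr≡encode : ∀ m A → length A ≡ m → AllPairs _<_ A → All (λ a → 1 ≤ a × a ≤ m * m) A →
              Tstr m A ≡ Encoding.encode (kOf m) (map (predCount A) (positions (m * m)))
Tstr≡encode _ A refl A-sorted A-bounded = begin
  Tstr m A
    ≡⟨ sym (concat-map-runs block (upTo (suc m)) (gaps (extA m A))) ⟩
  encode (runs (upTo (suc m)) (gaps (0 ∷ A ++ [ m * m ])))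
    ≡⟨ cong encode (runs-gaps id A A-sorted A-bounded z≤n) ⟩
  encode (map (predCount A) (interval 0 (m * m)))
    ≡⟨ cong (encode ∘ map (predCount A)) (sym (positions≡interval (m * m))) ⟩
  encode (map (predCount A) (positions (m * m))) ∎
  where
  open ≡-Reasoning
  m = length A
  open Encoding (kOf m)

mainTheorem11 : (m : ℕ) → 1 ≤ m → (A : List ℕ) → length A ≡ m → Linked _<_ A →
    All (λ a → 1 ≤ a × a ≤ m * m) A →
    (x : ℕ) → 1 ≤ x → x ≤ m * m →
    BWT (Tstr m A) (bOf m A + x) ≡ just (PredColor A x)
mainTheorem11 m _ A |A|≡m A-sorted A-bounded (suc n) _ n<m*m =
  subst (λ T → BWT T (markerCount k T + suc n) ≡ just (PredColor A (suc n)))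
        (sym (Tstr≡encode m A |A|≡m (Linked⇒AllPairs <-trans A-sorted) A-bounded))
        (BWT-encode-monotone (predCount A) (predCount-mono A) (predCount<2^kOf m A |A|≡m) (m * m) n n<m*m)
  where
  k = kOf m
  open Encoding k
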